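{- Let $\mathcal E$ be an essentially countable category and $\mathcal F$ a subcategory of $\mathcal E$ with $\mathrm{Ob}(\mathcal F)=\mathrm{Ob}(\mathcal E)$. If $\mathcal F$ is a projective Fra\"iss\'e category, then so is its domination closure $[\mathcal F]$ in $\mathcal E$. Moreover, every generic sequence for $\mathcal F$ is also a generic sequence for $[\mathcal F]$.
   Context: Essentially countable: objects countable up to isomorphism and countably many morphisms between any two objects. Projective Fra\"iss\'e category: essentially countable category with joint projection (for objects $o_1,o_2$ there are $e_1,e_2$ with $\mathrm{codom}(e_i)=o_i$ and common domain) and projective amalgamation (for $e_1,e_2$ with common codomain there are $e_1',e_2'$ with $e_1\circ e_1'=e_2\circ e_2'$). $\mathcal F$ is dominating in a set $X$ of morphisms if $g\circ f\in X$ for all $f\in\mathcal F$, $g\in X$ composable, and for each $g'\in X$ there is $g''\in X$ with $g'\circ g''\in\mathcal F$; $[\mathcal F]$ is the union of all $X\subseteq\mathcal E$ in which $\mathcal F$ is dominating. A neat sequence ($\mathrm{dom}(e_n)=\mathrm{codom}(e_{n+1})$) $(e_n)$ in a category $\mathcal G$ is generic if every object $o$ is the codomain of some $e\in\mathcal G$ with $\mathrm{dom}(e)=\mathrm{dom}(e_n)$ for some $n$, and for every $n$ and $e\in\mathcal G$ with $\mathrm{codom}(e)=\mathrm{codom}(e_n)$ there are $m>n$ and $e'\in\mathcal G$ with $e_n\circ\dots\circ e_m=e\circ e'$. -}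

module Defs where

open import Level using (Level; _⊔_) renaming (suc to lsuc)
open import Data.Nat using (ℕ; zero; suc; _+_)
open import Data.Maybe using (Maybe; just)
open import Data.Product using (Σ; ∃; ∃-syntax; _×_)
open import Data.Unit.Polymorphic using (⊤)
open import Relation.Binary.PropositionalEquality using (_≡_)

-- A (locally small, set-level) category; morphisms compared by ≡.
record Category (o m : Level) : Set (lsuc (o ⊔ m)) where
  infixr 9 _∘_
  field
    Ob   : Set o
    Hom  : Ob → Ob → Set m
    id   : ∀ {a} → Hom a a
    _∘_  : ∀ {a b c} → Hom b c → Hom a b → Hom a c
    assoc : ∀ {a b c d} (f : Hom a b) (g : Hom b c) (h : Hom c d) →
            (h ∘ g) ∘ f ≡ h ∘ (g ∘ f)
    identityˡ : ∀ {a b} (f : Hom a b) → id ∘ f ≡ f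
    identityʳ : ∀ {a b} (f : Hom a b) → f ∘ id ≡ f

module _ {o m : Level} (E : Category o m) where
  open Category E

  MorSet : (ℓ : Level) → Set (o ⊔ m ⊔ lsuc ℓ)
  MorSet ℓ = ∀ {a b} → Hom a b → Set ℓ

  AllMor : MorSet m
  AllMor _ = ⊤

  IsWideSubcategory : ∀ {ℓ} → MorSet ℓ → Set (o ⊔ m ⊔ ℓ)
  IsWideSubcategory G =
    (∀ {a} → G (id {a})) ×
    (∀ {a b c} (f : Hom a b) (g : Hom b c) → G f → G g → G (g ∘ f))

  CountableSub : ∀ {a ℓ} {A : Set a} → (A → Set ℓ) → Set (a ⊔ ℓ)
  CountableSub {A = A} S = Σ (ℕ → Maybe A) λ f → ∀ x → S x → ∃[ n ] f n ≡ just x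

  Iso : ∀ {ℓ} → MorSet ℓ → Ob → Ob → Set (m ⊔ ℓ)
  Iso G a b = Σ (Hom a b) λ f → Σ (Hom b a) λ g →
              G f × G g × (f ∘ g ≡ id) × (g ∘ f ≡ id)

  EssentiallyCountable : ∀ {ℓ} → MorSet ℓ → Set (o ⊔ m ⊔ ℓ)
  EssentiallyCountable G =
    (Σ (ℕ → Maybe Ob) λ f → ∀ x → ∃[ n ] ∃[ y ] (f n ≡ just y × Iso G x y)) ×
    (∀ a b → CountableSub {A = Hom a b} (λ h → G h))

  JointProjection : ∀ {ℓ} → MorSet ℓ → Set (o ⊔ m ⊔ ℓ)
  JointProjection G = ∀ o₁ o₂ → ∃[ c ] Σ (Hom c o₁) λ e₁ → Σ (Hom c o₂) λ e₂ →
                      G e₁ × G e₂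

  ProjectiveAmalgamation : ∀ {ℓ} → MorSet ℓ → Set (o ⊔ m ⊔ ℓ)
  ProjectiveAmalgamation G =
    ∀ {a b c} (e₁ : Hom a c) (e₂ : Hom b c) → G e₁ → G e₂ →
    ∃[ d ] Σ (Hom d a) λ e₁' → Σ (Hom d b) λ e₂' →
      G e₁' × G e₂' × (e₁ ∘ e₁' ≡ e₂ ∘ e₂')

  ProjectiveFraisse : ∀ {ℓ} → MorSet ℓ → Set (o ⊔ m ⊔ ℓ)
  ProjectiveFraisse G =
    EssentiallyCountable G × JointProjection G × ProjectiveAmalgamation G

  Dominating : ∀ {ℓ ℓ'} → MorSet ℓ → MorSet ℓ' → Set (o ⊔ m ⊔ ℓ ⊔ ℓ')
  Dominating F X =
    (∀ {a b c} (f : Hom a b) (g : Hom b c) → F f → X g → X (g ∘ f)) ×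
    (∀ {b c} (g' : Hom b c) → X g' → ∃[ a ] Σ (Hom a b) λ g'' → X g'' × F (g' ∘ g''))

  DomClosure : ∀ {ℓ} → MorSet ℓ → MorSet (lsuc (o ⊔ m ⊔ ℓ))
  DomClosure {ℓ} F g = Σ (MorSet (o ⊔ m ⊔ ℓ)) λ X → Dominating F X × X g

  record NeatSeq : Set (o ⊔ m) where
    field
      obj : ℕ → Ob
      mor : ∀ n → Hom (obj (suc n)) (obj n)

    -- chain n k = e n ∘ e (n+1) ∘ ... ∘ e (n+k)
    chain : ∀ n k → Hom (obj (suc (k + n))) (obj n)
    chain n zero = mor n
    chain n (suc k) = chain n k ∘ mor (suc (k + n))

  Generic : ∀ {ℓ} → MorSet ℓ → NeatSeq → Set (o ⊔ m ⊔ ℓ)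
  Generic G s =
    (∀ n → G (mor n)) ×
    (∀ x → ∃[ n ] Σ (Hom (obj (suc n)) x) λ e → G e) ×
    (∀ n {a} (e : Hom a (obj n)) → G e →
       -- m = suc k + n > n, and chain n (suc k) = e_n ∘ ... ∘ e_m
       ∃[ k ] Σ (Hom (obj (suc (suc k + n))) a) λ e' →
         G e' × (chain n (suc k) ≡ e ∘ e'))
    where open NeatSeq s

-- Every argument rests on two facts about a set X in which F is dominating:
-- X is closed under precomposition with F, and each g ∈ X has a "reach"
-- g'' ∈ X with g ∘ g'' ∈ F.
module Submission where

open import Defs
open import Level using (Level; _⊔_; Lift; lift; lower)
open import Data.Product using (_×_; Σ; _,_; proj₁; proj₂)
open import Data.Sum using (_⊎_; inj₁; inj₂)
open import Data.Unit.Polymorphic using (tt)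
open import Relation.Binary.PropositionalEquality
  using (_≡_; sym; trans; cong; subst; module ≡-Reasoning)

module Monotone {o m : Level} (E : Category o m) where
  open Category E

  _⊆_ : ∀ {ℓ ℓ'} → MorSet E ℓ → MorSet E ℓ' → Set (o ⊔ m ⊔ ℓ ⊔ ℓ')
  G ⊆ G' = ∀ {a b} {h : Hom a b} → G h → G' h

  iso-mono : ∀ {ℓ ℓ'} {G : MorSet E ℓ} {G' : MorSet E ℓ'} → G ⊆ G' →
             ∀ {a b} → Iso E G a b → Iso E G' a b
  iso-mono G⊆G' (f , g , Gf , Gg , fg , gf) = f , g , G⊆G' Gf , G⊆G' Gg , fg , gf

  -- Enlarging G keeps objects countable up to isomorphism; the hom-sets of
  -- G' stay countable because all of E is essentially countable.
  essentiallyCountable-mono : ∀ {ℓ ℓ'} {G : MorSet E ℓ} {G' : MorSet E ℓ'} →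
    G ⊆ G' → EssentiallyCountable E (AllMor E) → EssentiallyCountable E G →
    EssentiallyCountable E G'
  essentiallyCountable-mono {G = G} {G'} G⊆G' (_ , homsE) ((enum , covers) , _) =
      (enum , λ x → let (n , y , enum-n , x≅y) = covers x
                    in n , y , enum-n , iso-mono {G = G} {G'} G⊆G' x≅y)
    , λ a b → let (enumHom , coversHom) = homsE a b
              in enumHom , λ h _ → coversHom h tt

  jointProjection-mono : ∀ {ℓ ℓ'} {G : MorSet E ℓ} {G' : MorSet E ℓ'} →
    G ⊆ G' → JointProjection E G → JointProjection E G'
  jointProjection-mono G⊆G' jp o₁ o₂ =
    let (c , e₁ , e₂ , Ge₁ , Ge₂) = jp o₁ o₂ in c , e₁ , e₂ , G⊆G' Ge₁ , G⊆G' Ge₂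

module Closure {o m ℓ : Level} (E : Category o m) (F : MorSet E ℓ) where
  open Category E
  open Monotone E

  L : Level
  L = o ⊔ m ⊔ ℓ

  module Dominated {ℓx} {X : MorSet E ℓx} (dom : Dominating E F X) where
    absorb : ∀ {a b c} {f : Hom a b} {g : Hom b c} → X g → F f → X (g ∘ f)
    absorb Xg Ff = proj₁ dom _ _ Ff Xg

    reach : ∀ {b c} {g : Hom b c} → X g →
            Σ Ob λ a → Σ (Hom a b) λ g'' → X g'' × F (g ∘ g'')
    reach Xg = proj₂ dom _ Xg

  self-dominating : IsWideSubcategory E F → Dominating E F (λ h → Lift L (F h))
  self-dominating (F-id , F-comp) =
      (λ f g Ff Fg → lift (F-comp f g Ff (lower Fg)))
    , λ g Fg → _ , id , lift F-id , subst F (sym (identityʳ g)) (lower Fg)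

  ⊆-closure : IsWideSubcategory E F → F ⊆ DomClosure E F
  ⊆-closure wide Fh = _ , self-dominating wide , lift Fh

  dominating-∪ : ∀ {ℓx ℓy} {X : MorSet E ℓx} {Y : MorSet E ℓy} →
    Dominating E F X → Dominating E F Y → Dominating E F (λ h → X h ⊎ Y h)
  dominating-∪ domX domY =
      (λ { f g Ff (inj₁ Xg) → inj₁ (X.absorb Xg Ff)
         ; f g Ff (inj₂ Yg) → inj₂ (Y.absorb Yg Ff) })
    , λ { g (inj₁ Xg) → let (a , k , Xk , Fgk) = X.reach Xg in a , k , inj₁ Xk , Fgk
        ; g (inj₂ Yg) → let (a , k , Yk , Fgk) = Y.reach Yg in a , k , inj₂ Yk , Fgk }
    where
    module X = Dominated domX
    module Y = Dominated domY

  data Chains {p} (P : MorSet E p) : ∀ {a b} → Hom a b → Set (o ⊔ m ⊔ p) where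
    [_] : ∀ {a b} {h : Hom a b} → P h → Chains P h
    _∷_ : ∀ {a b c} {g : Hom b c} {h : Hom a b} → P g → Chains P h → Chains P (g ∘ h)

  module _ {p} {P : MorSet E p} (domP : Dominating E F P) where
    open Dominated domP

    snoc : ∀ {a b c} {g : Hom b c} {h : Hom a b} → Chains P g → P h → Chains P (g ∘ h)
    snoc [ Pg ] Ph = Pg ∷ [ Ph ]
    snoc {h = h} (_∷_ {g = g₁} {h = g₂} Pg₁ c) Ph =
      subst (Chains P) (sym (assoc h g₂ g₁)) (Pg₁ ∷ snoc c Ph)

    chain-absorb : ∀ {a b c} {g : Hom b c} {f : Hom a b} →
                   Chains P g → F f → Chains P (g ∘ f)
    chain-absorb [ Pg ] Ff = [ absorb Pg Ff ]
    chain-absorb {f = f} (_∷_ {g = g₁} {h = g₂} Pg₁ c) Ff =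
      subst (Chains P) (sym (assoc f g₂ g₁)) (Pg₁ ∷ chain-absorb c Ff)

    -- A chain g₁ ∘ h reaches F: first reach h ∘ k' ∈ F by induction, then
    -- g₁ ∘ (h ∘ k') ∈ P reaches F via some x ∈ P, giving k = k' ∘ x.
    chain-reach : ∀ {b c} {g : Hom b c} → Chains P g →
                  Σ Ob λ a → Σ (Hom a b) λ k → Chains P k × F (g ∘ k)
    chain-reach [ Pg ] = let (a , k , Pk , Fgk) = reach Pg in a , k , [ Pk ] , Fgk
    chain-reach (_∷_ {g = g₁} {h = h} Pg₁ c) =
      let (_ , k' , ck' , Fhk') = chain-reach c
          (a , x , Px , F-g₁hk'x) = reach (absorb Pg₁ Fhk')
          regroup : (g₁ ∘ h) ∘ (k' ∘ x) ≡ (g₁ ∘ (h ∘ k')) ∘ x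
          regroup = begin
            (g₁ ∘ h) ∘ (k' ∘ x)   ≡⟨ sym (assoc x k' (g₁ ∘ h)) ⟩
            ((g₁ ∘ h) ∘ k') ∘ x   ≡⟨ cong (_∘ x) (assoc k' h g₁) ⟩
            (g₁ ∘ (h ∘ k')) ∘ x   ∎
      in a , k' ∘ x , snoc ck' Px , subst F (sym regroup) F-g₁hk'x
      where open ≡-Reasoning

    dominating-chains : Dominating E F (Chains P)
    dominating-chains = (λ f g Ff cg → chain-absorb cg Ff) , λ g cg → chain-reach cg

  -- [F] is a wide subcategory: g ∘ f with f ∈ X, g ∈ Y is a chain over X ∪ Y.
  closure-wide : IsWideSubcategory E F → IsWideSubcategory E (DomClosure E F)
  closure-wide wide =
      ⊆-closure wide (proj₁ wide)
    , λ f g (X , domX , Xf) (Y , domY , Yg) →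
        _ , dominating-chains (dominating-∪ domX domY) , inj₂ Yg ∷ [ inj₁ Xf ]

  -- Amalgamate in F after reaching F from e₁ ∈ X and e₂ ∈ Y.
  closure-amalgamation : ProjectiveAmalgamation E F →
                         ProjectiveAmalgamation E (DomClosure E F)
  closure-amalgamation amalF e₁ e₂ (X , domX , Xe₁) (Y , domY , Ye₂) =
    let (_ , x , Xx , Fe₁x) = X.reach Xe₁
        (_ , y , Yy , Fe₂y) = Y.reach Ye₂
        (d , u , v , Fu , Fv , square) = amalF (e₁ ∘ x) (e₂ ∘ y) Fe₁x Fe₂y
    in d , x ∘ u , y ∘ v
       , (X , domX , X.absorb Xx Fu) , (Y , domY , Y.absorb Yy Fv)
       , trans (sym (assoc u x e₁)) (trans square (assoc v y e₂))
    where
    module X = Dominated domX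
    module Y = Dominated domY

  closure-fraisse : EssentiallyCountable E (AllMor E) → IsWideSubcategory E F →
                    ProjectiveFraisse E F → ProjectiveFraisse E (DomClosure E F)
  closure-fraisse countableE wide (countableF , jpF , amalF) =
      essentiallyCountable-mono (⊆-closure wide) countableE countableF
    , jointProjection-mono (⊆-closure wide) jpF
    , closure-amalgamation amalF

  -- Given e ∈ X into obj n, reach e ∘ x ∈ F and factor a chain through it
  -- by genericity for F; the factor x ∘ e' lies in X.
  closure-generic : IsWideSubcategory E F →
                    ∀ (s : NeatSeq E) → Generic E F s → Generic E (DomClosure E F) s
  closure-generic wide s (F-mor , F-cover , F-factor) =
      (λ n → ⊆-closure wide (F-mor n))
    , (λ x → let (n , e , Fe) = F-cover x in n , e , ⊆-closure wide Fe)
    , λ n e (X , domX , Xe) →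
        let open Dominated domX
            (_ , x , Xx , Fex) = reach Xe
            (k , e' , Fe' , factor) = F-factor n (e ∘ x) Fex
        in k , x ∘ e' , (X , domX , absorb Xx Fe') , trans factor (assoc e' x e)

corollary4p6 : ∀ {o m ℓ : Level} (E : Category o m) (F : MorSet E ℓ) →
    EssentiallyCountable E (AllMor E) →
    IsWideSubcategory E F →
    ProjectiveFraisse E F →
    (IsWideSubcategory E (DomClosure E F) × ProjectiveFraisse E (DomClosure E F)) ×
    (∀ (s : NeatSeq E) → Generic E F s → Generic E (DomClosure E F) s)
corollary4p6 E F countableE wide fraisseF =
    (closure-wide wide , closure-fraisse countableE wide fraisseF)
  , closure-generic wide
  where open Closure E F
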